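{- Let $G$ be a finite group, $H$ a normal subgroup of $G$, $\pi:G\to G/H$ the canonical epimorphism, $\overline{G}=G/H$, and let $\Gamma_1=\mathrm{Cay}(\overline{G},\overline{T})$ and $\Gamma_2=\mathrm{Cay}(H,S)$ be Cayley graphs. Let $\Gamma=\mathrm{Cay}(G,\pi^{ -1}(\overline{T})\cup S)$. Then $\mathrm{WL}(\Gamma)\leq\mathrm{WL}(\Gamma_2)\wr\mathrm{WL}(\Gamma_1)$ (as subrings of $\mathbb{Z}G$).
   Context: For $S\subseteq G$ with $e\notin S=S^{ -1}$, $\mathrm{Cay}(G,S)$ has vertex set $G$ and edges $\{g,sg\}$. For $X\subseteq G$ put $\underline{X}=\sum_{x\in X}x\in\mathbb{Z}G$. An S-ring over $G$ is a subring $\mathcal{A}\subseteq\mathbb{Z}G$ for which there is a partition $\mathcal{S}(\mathcal{A})$ of $G$ (basic sets) with $\{e\}\in\mathcal{S}(\mathcal{A})$, closed under $X\mapsto X^{ -1}$, and $\mathcal{A}=\mathrm{Span}_{\mathbb{Z}}\{\underline{X}:X\in\mathcal{S}(\mathcal{A})\}$. For a Cayley graph $\mathrm{Cay}(G,S)$, its WL-closure $\mathrm{WL}(\mathrm{Cay}(G,S))$ is the smallest S-ring over $G$ in which $S$ is a union of basic sets. If $L$ is normal in $K$, $\mathcal{A}_1$ an S-ring over $L$ and $\mathcal{A}_2$ an S-ring over $K/L$, the wreath product $\mathcal{A}_1\wr\mathcal{A}_2$ is the S-ring over $K$ whose basic sets are the basic sets of $\mathcal{A}_1$ together with the full preimages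 under $K\to K/L$ of the basic sets of $\mathcal{A}_2$ other than $\{L\}$. -}

module Defs where

open import Data.Bool using (Bool; true; false; _∧_; _∨_; not; _xor_)
open import Data.Nat using (ℕ)
open import Data.Integer using (ℤ; _+_; _*_; 0ℤ; 1ℤ)
open import Data.List using (List; []; _∷_; map; foldr; length; lookup; filterᵇ; _++_)
open import Data.List.Membership.Propositional using (_∈_)
open import Data.List.Relation.Unary.Unique.Propositional using (Unique)
open import Data.Bool.ListAction using (any; all)
open import Data.Vec using (Vec; []; _∷_)
open import Data.Fin using (Fin)
open import Data.Product using (Σ; ∃; ∃-syntax; _×_; _,_)
open import Relation.Binary.PropositionalEquality using (_≡_)
open import Relation.Binary.Definitions using (DecidableEquality)
open import Relation.Nullary.Decidable using (⌊_⌋)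
open import Algebra.Structures using (IsGroup)

record FinGroup : Set₁ where
  field
    Carrier  : Set
    _∙_      : Carrier → Carrier → Carrier
    ε        : Carrier
    _⁻¹      : Carrier → Carrier
    isGroup  : IsGroup _≡_ _∙_ ε _⁻¹
    _≟_      : DecidableEquality Carrier
    elems    : List Carrier
    complete : ∀ x → x ∈ elems
    unique   : Unique elems

open FinGroup public

record Hom (G K : FinGroup) : Set where
  field
    map₀  : Carrier G → Carrier K
    homo  : ∀ x y → map₀ (_∙_ G x y) ≡ _∙_ K (map₀ x) (map₀ y)

open Hom public

IsInjective : {G K : FinGroup} → Hom G K → Set
IsInjective f = ∀ x y → map₀ f x ≡ map₀ f y → x ≡ y

IsSurjective : {G K : FinGroup} → Hom G K → Set
IsSurjective {G} {K} f = ∀ y → ∃[ x ] map₀ f x ≡ y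

Subset : FinGroup → Set
Subset G = Carrier G → Bool

unitSet : (G : FinGroup) → Subset G
unitSet G g = ⌊ _≟_ G g (ε G) ⌋

union : (G : FinGroup) → Subset G → Subset G → Subset G
union G X Y g = X g ∨ Y g

image : {G K : FinGroup} → Hom G K → Subset G → Subset K
image {G} {K} f X k = any (λ g → X g ∧ ⌊ _≟_ K (map₀ f g) k ⌋) (elems G)

preimage : {G K : FinGroup} → Hom G K → Subset K → Subset G
preimage f Y g = Y (map₀ f g)

isUnitSet : (G : FinGroup) → Subset G → Bool
isUnitSet G X = all (λ g → not (X g xor unitSet G g)) (elems G)

IsCayleySet : (G : FinGroup) → Subset G → Set
IsCayleySet G S = (S (ε G) ≡ false) × (∀ g → S (_⁻¹ G g) ≡ S g)

ZG : FinGroup → Set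
ZG G = Carrier G → ℤ

sumOver : {A : Set} → List A → (A → ℤ) → ℤ
sumOver xs f = foldr _+_ 0ℤ (map f xs)

mulZG : (G : FinGroup) → ZG G → ZG G → ZG G
mulZG G f h x = sumOver (elems G) (λ y → f y * h (_∙_ G (_⁻¹ G y) x))

-- X̲ = Σ_{x∈X} x
underline : (G : FinGroup) → Subset G → ZG G
underline G X g with X g
... | true  = 1ℤ
... | false = 0ℤ

lincomb : (G : FinGroup) (L : List (Subset G)) → Vec ℤ (length L) → ZG G
lincomb G []      []       g = 0ℤ
lincomb G (X ∷ L) (c ∷ cs) g = c * underline G X g + lincomb G L cs g

InSpan : (G : FinGroup) → List (Subset G) → ZG G → Set
InSpan G L f = ∃[ c ] (∀ g → f g ≡ lincomb G L c g)

SubringLe : (G : FinGroup) → List (Subset G) → List (Subset G) → Set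
SubringLe G L L' = ∀ (f : ZG G) → InSpan G L f → InSpan G L' f

-- S-rings.  An S-ring is given by its list of basic sets L; the S-ring
-- itself is the subring Span_ℤ{X̲ : X ∈ L} of ℤG.

IsSRing : (G : FinGroup) → List (Subset G) → Set
IsSRing G L =
    (∀ i → ∃[ g ] lookup L i g ≡ true)
  × (∀ g → ∃[ i ] lookup L i g ≡ true)
  × (∀ g i j → lookup L i g ≡ true → lookup L j g ≡ true → i ≡ j)
  × (∃[ i ] (∀ g → lookup L i g ≡ unitSet G g))
  × (∀ i → ∃[ j ] (∀ g → lookup L j g ≡ lookup L i (_⁻¹ G g)))
  -- the span is a subring of ℤG (contains 1 = {e}̲ by the above; closed
  -- under +, − automatically; closed under multiplication:)
  × (∀ f h → InSpan G L f → InSpan G L h → InSpan G L (mulZG G f h))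

IsUnionOfBasic : (G : FinGroup) → List (Subset G) → Subset G → Set
IsUnionOfBasic G L S =
  Σ (Fin (length L) → Bool) λ sel →
    ∀ g → ((S g ≡ true → ∃[ i ] (sel i ≡ true × lookup L i g ≡ true))
         × (∀ i → sel i ≡ true → lookup L i g ≡ true → S g ≡ true))

-- L is (the basic-set list of) WL(Cay(G,S)): the smallest S-ring over G
-- in which S is a union of basic sets.
IsWL : (G : FinGroup) → Subset G → List (Subset G) → Set
IsWL G S L =
    IsSRing G L
  × IsUnionOfBasic G L S
  × (∀ (L' : List (Subset G)) → IsSRing G L' → IsUnionOfBasic G L' S → SubringLe G L L')

-- Wreath product A₁ ≀ A₂ over G, where the normal subgroup is ι(H) and
-- the quotient G/ι(H) is realised by π : G → Q: basic sets are the
-- (images of) basic sets of A₁ together with the full preimages of the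
-- basic sets of A₂ other than {e_Q}.

wreath : {H G Q : FinGroup} → Hom H G → Hom G Q →
         List (Subset H) → List (Subset Q) → List (Subset G)
wreath {H} {G} {Q} ι π L₁ L₂ =
  map (image {H} {G} ι) L₁ ++ map (preimage {G} {Q} π) (filterᵇ (λ X → not (isUnitSet Q X)) L₂)

{-# OPTIONS --safe #-}
-- The wreath product B₂ ≀ B₁ of B₂ = WL(Γ₂) and B₁ = WL(Γ₁) is itself an S-ring over G, and the
-- connection set π⁻¹(T̄) ∪ S of Γ is a union of its basic sets: S is a union of images of basic
-- sets of B₂, and π⁻¹(T̄) is the union of the preimages of the basic sets of B₁ inside T̄, none of
-- which is {e} because e ∉ T̄. Minimality of WL(Γ) then gives WL(Γ) ≤ B₂ ≀ B₁.
--
-- Apart from bookkeeping, the content is that B₂ ≀ B₁ is closed under multiplication. Its span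
-- consists exactly of the elements ι₊F + Φ∘π of ℤG with F : H → ℤ constant on the basic sets of
-- B₂ and Φ : G/H → ℤ constant on the basic sets of B₁, where ι₊F is F extended by zero from H to
-- G. Convolving such elements gives
--   (ι₊F + Φ∘π)(ι₊F′ + Φ′∘π) = ι₊(FF′) + (ΣF · Φ′ + ΣF′ · Φ + |H| · ΦΦ′)∘π,
-- which is again of this form because B₁ and B₂ are closed under multiplication.
module Submission where

open import Defs
open import Data.List using (List)
open import Data.Product using (∃-syntax; _×_)
open import Relation.Binary.PropositionalEquality using (_≡_)

open import Algebra.Bundles using (Group)
import Algebra.Properties.Group as GroupProperties
open import Data.Bool using (Bool; true; false; not; _∨_; _xor_; if_then_else_; T)
open import Data.Bool.ListAction using (all)
open import Data.Bool.Properties using (¬-not; T-≡; T-∧; T-not-≡; T?; ∨-zeroʳ)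
open import Data.Empty using (⊥; ⊥-elim)
open import Data.Fin using (Fin; zero; suc)
open import Data.Fin.Properties using (0≢1+n; suc-injective)
open import Data.Integer using (ℤ; _+_; _-_; _*_; 0ℤ; 1ℤ)
open import Data.Integer.Properties
  using (+-identityˡ; +-identityʳ; *-identityˡ; *-identityʳ; *-zeroʳ; *-comm; *-assoc; *-distribˡ-+)
open import Data.Integer.Tactic.RingSolver using (solve-∀)
open import Data.List using ([]; _∷_; map; length; lookup; filterᵇ)
open import Data.List.Membership.Propositional using (_∈_; _∉_; find; lose)
open import Data.List.Membership.Propositional.Properties
  using (∈-AllPairs₂; ∈-lookup; ∈-++⁻; ∈-++⁺ˡ; ∈-++⁺ʳ; ∈-map⁻; ∈-map⁺; ∈-filter⁻; ∈-filter⁺)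
open import Data.List.Relation.Unary.All using (All; []; _∷_)
import Data.List.Relation.Unary.All as All
import Data.List.Relation.Unary.All.Properties as Allₚ
open import Data.List.Relation.Unary.AllPairs using (AllPairs; []; _∷_)
import Data.List.Relation.Unary.AllPairs as AllPairs
import Data.List.Relation.Unary.AllPairs.Properties as AllPairsₚ
open import Data.List.Relation.Unary.Any using (Any; here; there)
import Data.List.Relation.Unary.Any as Any
open import Data.List.Relation.Unary.Any.Properties using (lookup-index; any⁺; any⁻)
open import Data.List.Relation.Unary.Unique.Propositional using (Unique)
open import Data.Product using (_,_; proj₁; proj₂; uncurry)
open import Data.Sum using (inj₁; inj₂)
open import Data.Vec using (Vec; []; _∷_)
open import Function using (_∘_)
open import Function.Bundles using (_⇔_; mk⇔; Equivalence)
open import Relation.Binary.Definitions using (DecidableEquality)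
open import Relation.Binary.PropositionalEquality
  using (refl; sym; trans; cong; cong₂; subst; subst₂; module ≡-Reasoning)
open import Relation.Nullary using (Dec; yes; no; ¬_; does)
open import Relation.Nullary.Decidable using (does-⇔; toWitness; fromWitness)

true≢false : true ≡ false → ⊥
true≢false ()

bool-ext : {a b : Bool} → (a ≡ true → b ≡ true) → (b ≡ true → a ≡ true) → a ≡ b
bool-ext {true}  {b}     a⇒b _   = sym (a⇒b refl)
bool-ext {false} {true}  _   b⇒a = b⇒a refl
bool-ext {false} {false} _   _   = refl

indicator : {P : Set} → Dec P → ℤ
indicator d = if does d then 1ℤ else 0ℤ

indicator-⇔ : {P P′ : Set} → P ⇔ P′ → (d : Dec P) (d′ : Dec P′) → indicator d ≡ indicator d′
indicator-⇔ P⇔P′ d d′ = cong (if_then 1ℤ else 0ℤ) (does-⇔ P⇔P′ d d′)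

-- Finite sums

module _ {A : Set} where

  sum-cong : (xs : List A) {f g : A → ℤ} → (∀ x → f x ≡ g x) → sumOver xs f ≡ sumOver xs g
  sum-cong []       f≗g = refl
  sum-cong (x ∷ xs) f≗g = cong₂ _+_ (f≗g x) (sum-cong xs f≗g)

  sum-+ : (xs : List A) (f g : A → ℤ) → sumOver xs (λ x → f x + g x) ≡ sumOver xs f + sumOver xs g
  sum-+ []       f g = refl
  sum-+ (x ∷ xs) f g = trans (cong (f x + g x +_) (sum-+ xs f g)) (interchange (f x) (g x) _ _)
    where
    interchange : ∀ a b c d → (a + b) + (c + d) ≡ (a + c) + (b + d)
    interchange = solve-∀

  sum-*ˡ : (xs : List A) (c : ℤ) (f : A → ℤ) → sumOver xs (λ x → c * f x) ≡ c * sumOver xs f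
  sum-*ˡ []       c f = sym (*-zeroʳ c)
  sum-*ˡ (x ∷ xs) c f = trans (cong (c * f x +_) (sum-*ˡ xs c f)) (sym (*-distribˡ-+ c (f x) _))

  sum-*ʳ : (xs : List A) (c : ℤ) (f : A → ℤ) → sumOver xs (λ x → f x * c) ≡ sumOver xs f * c
  sum-*ʳ xs c f = trans (sum-cong xs (λ x → *-comm (f x) c)) (trans (sum-*ˡ xs c f) (*-comm c _))

  sum-zero : (xs : List A) → sumOver xs (λ _ → 0ℤ) ≡ 0ℤ
  sum-zero []       = refl
  sum-zero (x ∷ xs) = trans (+-identityˡ _) (sum-zero xs)

sum-swap : {A B : Set} (xs : List A) (ys : List B) (F : A → B → ℤ) →
           sumOver xs (λ x → sumOver ys (F x)) ≡ sumOver ys (λ y → sumOver xs (λ x → F x y))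
sum-swap []       ys F = sym (sum-zero ys)
sum-swap (x ∷ xs) ys F = trans (cong (sumOver ys (F x) +_) (sum-swap xs ys F))
                               (sym (sum-+ ys (F x) (λ y → sumOver xs (λ x′ → F x′ y))))

module _ {A : Set} (_≟_ : DecidableEquality A) where

  sum-indicator-∉ : {a : A} (xs : List A) (Φ : A → ℤ) → a ∉ xs →
                    sumOver xs (λ x → indicator (a ≟ x) * Φ x) ≡ 0ℤ
  sum-indicator-∉     []       Φ a∉ = refl
  sum-indicator-∉ {a} (x ∷ xs) Φ a∉ with a ≟ x
  ... | yes a≡x = ⊥-elim (a∉ (here a≡x))
  ... | no  _   = trans (+-identityˡ _) (sum-indicator-∉ xs Φ (λ a∈ → a∉ (there a∈)))

  sum-δ : {a : A} (xs : List A) (Φ : A → ℤ) → Unique xs → a ∈ xs →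
          sumOver xs (λ x → indicator (a ≟ x) * Φ x) ≡ Φ a
  sum-δ {a} (x ∷ xs) Φ (x∉xs ∷ _) (here refl) with a ≟ a
  ... | no  a≢a = ⊥-elim (a≢a refl)
  ... | yes _   = trans (cong₂ _+_ (*-identityˡ (Φ a)) (sum-indicator-∉ xs Φ a∉xs)) (+-identityʳ (Φ a))
    where
    a∉xs : a ∉ xs
    a∉xs a∈xs = All.lookup x∉xs a∈xs refl
  sum-δ {a} (x ∷ xs) Φ (x∉xs ∷ unique) (there a∈xs) with a ≟ x
  ... | yes refl = ⊥-elim (All.lookup x∉xs a∈xs refl)
  ... | no  _    = trans (+-identityˡ _) (sum-δ xs Φ unique a∈xs)

  sum-fibres : {B : Set} (xs : List B) (ys : List A) (f : B → A) (Φ : A → ℤ) →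
               Unique ys → (∀ x → f x ∈ ys) →
               sumOver xs (λ x → Φ (f x)) ≡ sumOver ys (λ y → sumOver xs (λ x → indicator (f x ≟ y)) * Φ y)
  sum-fibres xs ys f Φ unique covers = begin
    sumOver xs (λ x → Φ (f x))
      ≡⟨ sum-cong xs (λ x → sym (sum-δ ys Φ unique (covers x))) ⟩
    sumOver xs (λ x → sumOver ys (λ y → indicator (f x ≟ y) * Φ y))
      ≡⟨ sum-swap xs ys _ ⟩
    sumOver ys (λ y → sumOver xs (λ x → indicator (f x ≟ y) * Φ y))
      ≡⟨ sum-cong ys (λ y → sum-*ʳ xs (Φ y) _) ⟩
    sumOver ys (λ y → sumOver xs (λ x → indicator (f x ≟ y)) * Φ y)
      ∎
    where open ≡-Reasoning

-- Finite groups and their group rings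

asGroup : FinGroup → Group _ _
asGroup G = record { isGroup = isGroup G }

module GroupTheory (G : FinGroup) where
  open Group (asGroup G) public
  open GroupProperties (asGroup G) public

module _ {G K : FinGroup} (φ : Hom G K) where
  private
    module G = GroupTheory G
    module K = GroupTheory K

  hom-ε : map₀ φ G.ε ≡ K.ε
  hom-ε = K.identityʳ-unique _ _ (trans (sym (homo φ G.ε G.ε)) (cong (map₀ φ) (G.identityˡ G.ε)))

  hom-⁻¹ : ∀ g → map₀ φ (g G.⁻¹) ≡ map₀ φ g K.⁻¹
  hom-⁻¹ g = K.inverseˡ-unique _ _
    (trans (sym (homo φ (g G.⁻¹) g)) (trans (cong (map₀ φ) (G.inverseˡ g)) hom-ε))

module _ (G : FinGroup) where
  private module G = GroupTheory G

  sum-translate : (c : Carrier G) (F : Carrier G → ℤ) →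
                  sumOver (elems G) (λ z → F (c G.∙ z)) ≡ sumOver (elems G) F
  sum-translate c F = begin
    sumOver xs (λ z → F (c G.∙ z))
      ≡⟨ sum-fibres (_≟_ G) xs xs (c G.∙_) F (unique G) (λ _ → complete G _) ⟩
    sumOver xs (λ y → sumOver xs (λ z → indicator (_≟_ G (c G.∙ z) y)) * F y)
      ≡⟨ sum-cong xs (λ y → cong (_* F y) (one-preimage y)) ⟩
    sumOver xs (λ y → 1ℤ * F y)
      ≡⟨ sum-cong xs (λ y → *-identityˡ (F y)) ⟩
    sumOver xs F
      ∎
    where
    open ≡-Reasoning
    xs = elems G
    solve-for : ∀ y z → (c G.∙ z ≡ y) ⇔ (c G.\\ y ≡ z)
    solve-for y z = mk⇔ (λ cz≡y → sym (G.y≈x\\z c z y cz≡y)) (λ { refl → G.\\-leftDividesˡ c y })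
    one-preimage : ∀ y → sumOver xs (λ z → indicator (_≟_ G (c G.∙ z) y)) ≡ 1ℤ
    one-preimage y = trans
      (sum-cong xs (λ z → trans (indicator-⇔ (solve-for y z) (_≟_ G (c G.∙ z) y) (_≟_ G (c G.\\ y) z))
                                (sym (*-identityʳ _))))
      (sum-δ (_≟_ G) xs (λ _ → 1ℤ) (unique G) (complete G (c G.\\ y)))

  mulZG-cong : {u u′ v v′ : ZG G} → (∀ g → u g ≡ u′ g) → (∀ g → v g ≡ v′ g) →
               ∀ x → mulZG G u v x ≡ mulZG G u′ v′ x
  mulZG-cong u≗u′ v≗v′ x = sum-cong (elems G) (λ y → cong₂ _*_ (u≗u′ y) (v≗v′ (y G.\\ x)))

  mulZG-expand : (a b c d : ZG G) (x : Carrier G) →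
                 mulZG G (λ g → a g + b g) (λ g → c g + d g) x
                 ≡ mulZG G a c x + mulZG G a d x + mulZG G b c x + mulZG G b d x
  mulZG-expand a b c d x = begin
    sumOver xs (λ y → (a y + b y) * (c (y G.\\ x) + d (y G.\\ x)))
      ≡⟨ sum-cong xs (λ y → expand (a y) (b y) (c (y G.\\ x)) (d (y G.\\ x))) ⟩
    sumOver xs (λ y → a y * c (y G.\\ x) + a y * d (y G.\\ x) + b y * c (y G.\\ x) + b y * d (y G.\\ x))
      ≡⟨ sum-+ xs _ _ ⟩
    sumOver xs (λ y → a y * c (y G.\\ x) + a y * d (y G.\\ x) + b y * c (y G.\\ x)) + mulZG G b d x
      ≡⟨ cong (_+ mulZG G b d x) (sum-+ xs _ _) ⟩
    sumOver xs (λ y → a y * c (y G.\\ x) + a y * d (y G.\\ x)) + mulZG G b c x + mulZG G b d x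
      ≡⟨ cong (λ s → s + mulZG G b c x + mulZG G b d x) (sum-+ xs _ _) ⟩
    mulZG G a c x + mulZG G a d x + mulZG G b c x + mulZG G b d x
      ∎
    where
    open ≡-Reasoning
    xs = elems G
    expand : ∀ a b c d → (a + b) * (c + d) ≡ a * c + a * d + b * c + b * d
    expand = solve-∀

-- Partitions and block-constant functions

module _ {A : Set} where

  Disjoint : (A → Bool) → (A → Bool) → Set
  Disjoint X Y = ∀ g → X g ≡ true → Y g ≡ false

  SameBlock : List (A → Bool) → A → A → Set
  SameBlock L g g′ = Any (λ X → X g ≡ true × X g′ ≡ true) L

  Constant : List (A → Bool) → (A → ℤ) → Set
  Constant L f = ∀ {g g′} → SameBlock L g g′ → f g ≡ f g′

  record IsPartition (L : List (A → Bool)) : Set where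
    field
      nonempty : All (λ X → ∃[ g ] X g ≡ true) L
      covers   : ∀ g → Any (λ X → X g ≡ true) L
      disjoint : AllPairs Disjoint L

  disjoint-sym : {X Y : A → Bool} → Disjoint X Y → Disjoint Y X
  disjoint-sym X∩Y g Yg = ¬-not (λ Xg → true≢false (trans (sym Yg) (X∩Y g Xg)))

  disjoint-from-block : (X : A → Bool) {L : List (A → Bool)} {g : A} →
                        All (Disjoint X) L → Any (λ Y → Y g ≡ true) L → X g ≡ false
  disjoint-from-block X X∩L Lg with find Lg
  ... | Y , Y∈L , Yg = disjoint-sym (All.lookup X∩L Y∈L) _ Yg

  block-unique : {L : List (A → Bool)} {X Y : A → Bool} {g : A} → AllPairs Disjoint L →
                 X ∈ L → Y ∈ L → X g ≡ true → Y g ≡ true → X ≡ Y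
  block-unique disjoint X∈L Y∈L Xg Yg with ∈-AllPairs₂ disjoint X∈L Y∈L
  ... | inj₁ X≡Y         = X≡Y
  ... | inj₂ (inj₁ X∩Y) = ⊥-elim (true≢false (trans (sym Yg) (X∩Y _ Xg)))
  ... | inj₂ (inj₂ Y∩X) = ⊥-elim (true≢false (trans (sym Xg) (Y∩X _ Yg)))

  constant-+ : {L : List (A → Bool)} {f h : A → ℤ} →
               Constant L f → Constant L h → Constant L (λ g → f g + h g)
  constant-+ f-constant h-constant same = cong₂ _+_ (f-constant same) (h-constant same)

  constant-*ˡ : {L : List (A → Bool)} (c : ℤ) {f : A → ℤ} → Constant L f → Constant L (λ g → c * f g)
  constant-*ˡ c f-constant same = cong (c *_) (f-constant same)

module _ (G : FinGroup) where

  underline-true : (X : Subset G) {g : Carrier G} → X g ≡ true → underline G X g ≡ 1ℤ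
  underline-true X {g} Xg with X g
  ... | true = refl

  underline-false : (X : Subset G) {g : Carrier G} → X g ≡ false → underline G X g ≡ 0ℤ
  underline-false X {g} Xg with X g
  ... | false = refl

  lincomb-outside : (L : List (Subset G)) (c : Vec ℤ (length L)) {g : Carrier G} →
                    All (λ X → X g ≡ false) L → lincomb G L c g ≡ 0ℤ
  lincomb-outside []      []       []         = refl
  lincomb-outside (X ∷ L) (c ∷ cs) (Xg ∷ L∌g) =
    trans (cong₂ (λ u r → c * u + r) (underline-false X Xg) (lincomb-outside L cs L∌g))
          (trans (+-identityʳ _) (*-zeroʳ c))

  lincomb-head : (X : Subset G) (L : List (Subset G)) (c : ℤ) (cs : Vec ℤ (length L)) {g : Carrier G} →
                 All (Disjoint X) L → X g ≡ true → lincomb G (X ∷ L) (c ∷ cs) g ≡ c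
  lincomb-head X L c cs X∩L Xg =
    trans (cong₂ (λ u r → c * u + r) (underline-true X Xg) (lincomb-outside L cs (All.map (λ X∩Y → X∩Y _ Xg) X∩L)))
          (trans (+-identityʳ _) (*-identityʳ c))

  lincomb-tail : (X : Subset G) (L : List (Subset G)) (c : ℤ) (cs : Vec ℤ (length L)) {g : Carrier G} →
                 X g ≡ false → lincomb G (X ∷ L) (c ∷ cs) g ≡ lincomb G L cs g
  lincomb-tail X L c cs Xg =
    trans (cong (λ u → c * u + _) (underline-false X Xg)) (trans (cong (_+ _) (*-zeroʳ c)) (+-identityˡ _))

  inSpan⇒constant : {L : List (Subset G)} {f : ZG G} → AllPairs Disjoint L → InSpan G L f → Constant L f
  inSpan⇒constant disjoint (c , f≗) {g} {g′} same =
    trans (f≗ g) (trans (lincomb-sameBlock disjoint c same) (sym (f≗ g′)))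
    where
    lincomb-sameBlock : {L : List (Subset G)} → AllPairs Disjoint L → (c : Vec ℤ (length L)) {g g′ : Carrier G} →
                        SameBlock L g g′ → lincomb G L c g ≡ lincomb G L c g′
    lincomb-sameBlock {X ∷ L} (X∩L ∷ _) (c ∷ cs) (here (Xg , Xg′)) =
      trans (lincomb-head X L c cs X∩L Xg) (sym (lincomb-head X L c cs X∩L Xg′))
    lincomb-sameBlock {X ∷ L} (X∩L ∷ disjoint) (c ∷ cs) (there same) =
      trans (lincomb-tail X L c cs (disjoint-from-block X X∩L (Any.map proj₁ same)))
     (trans (lincomb-sameBlock disjoint cs same)
            (sym (lincomb-tail X L c cs (disjoint-from-block X X∩L (Any.map proj₂ same)))))

  constant⇒inSpan : {L : List (Subset G)} {f : ZG G} → IsPartition L → Constant L f → InSpan G L f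
  constant⇒inSpan {f = f} partition f-constant =
    coefficients nonempty , λ g → at-block disjoint nonempty f-constant (covers g)
    where
    open IsPartition partition
    coefficients : {L : List (Subset G)} → All (λ X → ∃[ g ] X g ≡ true) L → Vec ℤ (length L)
    coefficients []              = []
    coefficients ((w , _) ∷ ne)  = f w ∷ coefficients ne
    at-block : {L : List (Subset G)} → AllPairs Disjoint L → (ne : All (λ X → ∃[ g ] X g ≡ true) L) →
               Constant L f → {g : Carrier G} → Any (λ X → X g ≡ true) L → f g ≡ lincomb G L (coefficients ne) g
    at-block {X ∷ L} (X∩L ∷ _) ((w , Xw) ∷ ne) f-constant (here Xg) =
      trans (f-constant (here (Xg , Xw))) (sym (lincomb-head X L (f w) (coefficients ne) X∩L Xg))
    at-block {X ∷ L} (X∩L ∷ disjoint) ((w , _) ∷ ne) f-constant (there Lg) =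
      trans (at-block disjoint ne (f-constant ∘ there) Lg)
            (sym (lincomb-tail X L (f w) (coefficients ne) (disjoint-from-block X X∩L Lg)))

-- S-rings

module _ {A : Set} {P : A → Set} {L : List A} where

  all⇒lookup : All P L → ∀ i → P (lookup L i)
  all⇒lookup ps i = All.lookup ps (∈-lookup i)

  lookup⇒all : (∀ i → P (lookup L i)) → All P L
  lookup⇒all ps = All.tabulate (λ x∈L → subst P (sym (lookup-index x∈L)) (ps (Any.index x∈L)))

  any⇒lookup : Any P L → ∃[ i ] P (lookup L i)
  any⇒lookup p = Any.index p , lookup-index p

  lookup⇒any : ∃[ i ] P (lookup L i) → Any P L
  lookup⇒any (i , p) = lose (∈-lookup i) p

module _ {A : Set} where

  allPairs⇒index-unique : {L : List (A → Bool)} → AllPairs Disjoint L →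
                          ∀ g i j → lookup L i g ≡ true → lookup L j g ≡ true → i ≡ j
  allPairs⇒index-unique (_ ∷ _)          g zero    zero    _   _   = refl
  allPairs⇒index-unique (X∩L ∷ _)        g zero    (suc j) Xg  Ljg =
    ⊥-elim (true≢false (trans (sym Ljg) (all⇒lookup X∩L j g Xg)))
  allPairs⇒index-unique (X∩L ∷ _)        g (suc i) zero    Lig Xg  =
    ⊥-elim (true≢false (trans (sym Lig) (all⇒lookup X∩L i g Xg)))
  allPairs⇒index-unique (_ ∷ disjoint) g (suc i) (suc j) Lig Ljg =
    cong suc (allPairs⇒index-unique disjoint g i j Lig Ljg)

  index-unique⇒allPairs : {L : List (A → Bool)} →
                          (∀ g i j → lookup L i g ≡ true → lookup L j g ≡ true → i ≡ j) → AllPairs Disjoint L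
  index-unique⇒allPairs {[]}    _      = []
  index-unique⇒allPairs {X ∷ L} unique =
    lookup⇒all (λ j g Xg → ¬-not (λ Ljg → 0≢1+n (unique g zero (suc j) Xg Ljg)))
    ∷ index-unique⇒allPairs (λ g i j Lig Ljg → suc-injective (unique g (suc i) (suc j) Lig Ljg))

module _ (G : FinGroup) where
  private module G = GroupTheory G

  IsUnitBlock : Subset G → Set
  IsUnitBlock X = ∀ g → X g ≡ unitSet G g

  InverseOf : Subset G → Subset G → Set
  InverseOf X Y = ∀ g → Y g ≡ X (g G.⁻¹)

  unitSet-ε : unitSet G G.ε ≡ true
  unitSet-ε = Equivalence.to T-≡ (fromWitness refl)

  unitSet-true : {g : Carrier G} → unitSet G g ≡ true → g ≡ G.ε
  unitSet-true ug = toWitness (Equivalence.from T-≡ ug)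

  isUnitSet⇒ : {X : Subset G} → isUnitSet G X ≡ true → IsUnitBlock X
  isUnitSet⇒ isUnit g = xnor⇒≡ (All.lookup (Allₚ.all⁺ _ (elems G) (Equivalence.from T-≡ isUnit)) (complete G g))
    where
    xnor⇒≡ : {a b : Bool} → T (not (a xor b)) → a ≡ b
    xnor⇒≡ {true}  {true}  _ = refl
    xnor⇒≡ {false} {false} _ = refl

  ⇒isUnitSet : {X : Subset G} → IsUnitBlock X → isUnitSet G X ≡ true
  ⇒isUnitSet unitBlock = Equivalence.to T-≡ (Allₚ.all⁻ _ {elems G} (All.tabulate (λ {g} _ →
    subst (λ b → T (not (b xor unitSet G g))) (sym (unitBlock g)) (xnor-refl (unitSet G g)))))
    where
    xnor-refl : (a : Bool) → T (not (a xor a))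
    xnor-refl true  = _
    xnor-refl false = _

module BasicSets {G : FinGroup} {L : List (Subset G)} (sRing : IsSRing G L) where
  private module G = GroupTheory G

  partition : IsPartition L
  partition = record
    { nonempty = lookup⇒all (proj₁ sRing)
    ; covers   = λ g → lookup⇒any (proj₁ (proj₂ sRing) g)
    ; disjoint = index-unique⇒allPairs (proj₁ (proj₂ (proj₂ sRing)))
    }

  open IsPartition partition public

  unitBlock : Any (IsUnitBlock G) L
  unitBlock = lookup⇒any (proj₁ (proj₂ (proj₂ (proj₂ sRing))))

  inverses : All (λ X → Any (InverseOf G X) L) L
  inverses = lookup⇒all (λ i → lookup⇒any (proj₁ (proj₂ (proj₂ (proj₂ (proj₂ sRing)))) i))

  constant-mul : {f h : ZG G} → Constant L f → Constant L h → Constant L (mulZG G f h)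
  constant-mul f-constant h-constant = inSpan⇒constant G disjoint
    (proj₂ (proj₂ (proj₂ (proj₂ (proj₂ sRing)))) _ _
      (constant⇒inSpan G partition f-constant) (constant⇒inSpan G partition h-constant))

  block-of-ε : {X : Subset G} → X ∈ L → X G.ε ≡ true → IsUnitBlock G X
  block-of-ε X∈L Xε with find unitBlock
  ... | U , U∈L , U-unit rewrite block-unique disjoint X∈L U∈L Xε (trans (U-unit G.ε) (unitSet-ε G)) = U-unit

  avoids-ε : {X : Subset G} {g : Carrier G} → X ∈ L → X g ≡ true → ¬ g ≡ G.ε → X G.ε ≡ false
  avoids-ε X∈L Xg g≢ε = ¬-not (λ Xε → g≢ε (unitSet-true G (trans (sym (block-of-ε X∈L Xε _)) Xg)))

  sameBlock-ε : {g g′ : Carrier G} → SameBlock L g g′ → g ≡ G.ε → g′ ≡ G.ε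
  sameBlock-ε same refl with find same
  ... | X , X∈L , Xε , Xg′ = unitSet-true G (trans (sym (block-of-ε X∈L Xε _)) Xg′)

  isUnitSet-basic : {X : Subset G} → X ∈ L → isUnitSet G X ≡ X G.ε
  isUnitSet-basic {X} X∈L with X G.ε in Xε
  ... | true  = ⇒isUnitSet G (block-of-ε X∈L Xε)
  ... | false = ¬-not (λ isUnit → true≢false (trans (sym (trans (isUnitSet⇒ G {X} isUnit G.ε) (unitSet-ε G))) Xε))

isSRing : {G : FinGroup} {L : List (Subset G)} →
          IsPartition L → Any (IsUnitBlock G) L → All (λ X → Any (InverseOf G X) L) L →
          (∀ {f h} → Constant L f → Constant L h → Constant L (mulZG G f h)) → IsSRing G L
isSRing {G} partition unitBlock inverses constant-mul =
    all⇒lookup nonempty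
  , (λ g → any⇒lookup (covers g))
  , allPairs⇒index-unique disjoint
  , any⇒lookup unitBlock
  , (λ i → any⇒lookup (all⇒lookup inverses i))
  , λ f h f∈ h∈ → constant⇒inSpan G partition
                    (constant-mul (inSpan⇒constant G disjoint f∈) (inSpan⇒constant G disjoint h∈))
  where open IsPartition partition

module _ (G : FinGroup) where

  _⊆ᵇ_ : Subset G → Subset G → Set
  X ⊆ᵇ S = ∀ g → X g ≡ true → S g ≡ true

  CoveredByBlocks : List (Subset G) → Subset G → Set
  CoveredByBlocks L S = ∀ g → S g ≡ true → Any (λ X → X g ≡ true × X ⊆ᵇ S) L

  isUnionOfBasic⇒covered : (L : List (Subset G)) {S : Subset G} → IsUnionOfBasic G L S → CoveredByBlocks L S
  isUnionOfBasic⇒covered L (selected , union) g Sg with proj₁ (union g) Sg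
  ... | i , selected-i , Lig = lookup⇒any (i , Lig , λ g′ Lig′ → proj₂ (union g′) i selected-i Lig′)

  covered⇒isUnionOfBasic : (L : List (Subset G)) {S : Subset G} → CoveredByBlocks L S → IsUnionOfBasic G L S
  covered⇒isUnionOfBasic L {S} covered =
    inside , λ g → (λ Sg → selected (covered g Sg)) , λ i i⊆S → within i i⊆S g
    where
    inside : Fin (length L) → Bool
    inside i = all (λ g → not (lookup L i g) ∨ S g) (elems G)
    selected : {g : Carrier G} → Any (λ X → X g ≡ true × X ⊆ᵇ S) L →
               ∃[ i ] (inside i ≡ true × lookup L i g ≡ true)
    selected block with any⇒lookup block
    ... | i , Lig , Li⊆S =
      i , Equivalence.to T-≡ (Allₚ.all⁻ _ {elems G} (All.tabulate (λ {g} _ → implication (Li⊆S g)))) , Lig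
      where
      implication : {a b : Bool} → (a ≡ true → b ≡ true) → T (not a ∨ b)
      implication {true}  a⇒b = Equivalence.from T-≡ (a⇒b refl)
      implication {false} _   = _
    within : ∀ i → inside i ≡ true → lookup L i ⊆ᵇ S
    within i i⊆S g = modus-ponens (All.lookup (Allₚ.all⁺ _ (elems G) (Equivalence.from T-≡ i⊆S)) (complete G g))
      where
      modus-ponens : {a b : Bool} → T (not a ∨ b) → a ≡ true → b ≡ true
      modus-ponens {true} b refl = Equivalence.to T-≡ b

module _ {G K : FinGroup} (f : Hom G K) where
  private
    module G = GroupTheory G
    module K = GroupTheory K

  image⁻ : {X : Subset G} {k : Carrier K} → image f X k ≡ true → ∃[ g ] X g ≡ true × map₀ f g ≡ k
  image⁻ {X} fXk with find (any⁻ _ (elems G) (Equivalence.from T-≡ fXk))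
  ... | g , _ , Xg∧fg≡k with Equivalence.to (T-∧ {X g}) Xg∧fg≡k
  ...   | Xg , fg≡k = g , Equivalence.to T-≡ Xg , toWitness fg≡k

  image⁺ : {X : Subset G} {g : Carrier G} → X g ≡ true → image f X (map₀ f g) ≡ true
  image⁺ {X} {g} Xg = Equivalence.to T-≡
    (any⁺ _ (lose (complete G g) (Equivalence.from (T-∧ {X g}) (Equivalence.from T-≡ Xg , fromWitness refl))))

  image-inverse : {X Y : Subset G} → InverseOf G X Y → InverseOf K (image f X) (image f Y)
  image-inverse {X} {Y} Y≡X⁻¹ k = bool-ext to from
    where
    to : image f Y k ≡ true → image f X (k K.⁻¹) ≡ true
    to fYk with image⁻ fYk
    ... | g , Yg , refl = subst (λ k′ → image f X k′ ≡ true) (hom-⁻¹ f g) (image⁺ (trans (sym (Y≡X⁻¹ g)) Yg))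
    from : image f X (k K.⁻¹) ≡ true → image f Y k ≡ true
    from fXk⁻¹ with image⁻ fXk⁻¹
    ... | g , Xg , fg≡k⁻¹ = subst (λ k′ → image f Y k′ ≡ true)
      (trans (hom-⁻¹ f g) (trans (cong K._⁻¹ fg≡k⁻¹) (K.⁻¹-involutive k)))
      (image⁺ (trans (Y≡X⁻¹ (g G.⁻¹)) (trans (cong X (G.⁻¹-involutive g)) Xg)))

  image-unitBlock : {X : Subset G} → IsUnitBlock G X → IsUnitBlock K (image f X)
  image-unitBlock {X} X-unit k = bool-ext to from
    where
    to : image f X k ≡ true → unitSet K k ≡ true
    to fXk with image⁻ fXk
    ... | g , Xg , refl rewrite unitSet-true G (trans (sym (X-unit g)) Xg) | hom-ε f = unitSet-ε K
    from : unitSet K k ≡ true → image f X k ≡ true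
    from uk rewrite unitSet-true K uk =
      subst (λ k′ → image f X k′ ≡ true) (hom-ε f) (image⁺ (trans (X-unit G.ε) (unitSet-ε G)))

  image-disjoint : IsInjective f → {X Y : Subset G} → Disjoint X Y → Disjoint (image f X) (image f Y)
  image-disjoint f-injective {X} {Y} X∩Y k fXk = ¬-not λ fYk → true≢false (clash (image⁻ fXk) (image⁻ fYk))
    where
    clash : ∃[ g ] X g ≡ true × map₀ f g ≡ k → ∃[ g ] Y g ≡ true × map₀ f g ≡ k → true ≡ false
    clash (g , Xg , refl) (g′ , Yg′ , fg′≡fg) rewrite f-injective g′ g fg′≡fg = trans (sym Yg′) (X∩Y g Xg)

-- Group extensions H ↪ G ↠ Q

module Extension (G H Q : FinGroup) (ι : Hom H G) (π : Hom G Q)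
                 (ι-injective : IsInjective ι) (π-surjective : IsSurjective π)
                 (exact : ∀ g → (map₀ π g ≡ ε Q → ∃[ h ] map₀ ι h ≡ g)
                                × (∀ h → map₀ π (map₀ ι h) ≡ ε Q)) where
  private
    module G = GroupTheory G
    module H = GroupTheory H
    module Q = GroupTheory Q
    ι₀ = map₀ ι
    π₀ = map₀ π

  kernel⊆image : ∀ {g} → π₀ g ≡ Q.ε → ∃[ h ] ι₀ h ≡ g
  kernel⊆image {g} = proj₁ (exact g)

  π∘ι≡ε : ∀ h → π₀ (ι₀ h) ≡ Q.ε
  π∘ι≡ε = proj₂ (exact G.ε)

  π-ι⁻¹ : ∀ h → π₀ (ι₀ h G.⁻¹) ≡ Q.ε
  π-ι⁻¹ h = trans (hom-⁻¹ π (ι₀ h)) (trans (cong Q._⁻¹ (π∘ι≡ε h)) Q.ε⁻¹≈ε)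

  π-ι\\ : ∀ h x → π₀ (ι₀ h G.\\ x) ≡ π₀ x
  π-ι\\ h x = trans (homo π _ x) (trans (cong (Q._∙ π₀ x) (π-ι⁻¹ h)) (Q.identityˡ (π₀ x)))

  π-//ι : ∀ h x → π₀ (x G.// ι₀ h) ≡ π₀ x
  π-//ι h x = trans (homo π x _) (trans (cong (π₀ x Q.∙_) (π-ι⁻¹ h)) (Q.identityʳ (π₀ x)))

  -- Extension of F by zero, written as a sum so that products with it are sum manipulations.
  ι₊ : (Carrier H → ℤ) → ZG G
  ι₊ F g = sumOver (elems H) (λ h → indicator (_≟_ G (ι₀ h) g) * F h)

  ι₊-at-ι : (F : Carrier H → ℤ) (a : Carrier H) → ι₊ F (ι₀ a) ≡ F a
  ι₊-at-ι F a = trans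
    (sum-cong (elems H) (λ h → cong (_* F h) (indicator-⇔ (ιh≡ιa⇔a≡h h) (_≟_ G (ι₀ h) (ι₀ a)) (_≟_ H a h))))
    (sum-δ (_≟_ H) (elems H) F (unique H) (complete H a))
    where
    ιh≡ιa⇔a≡h : ∀ h → (ι₀ h ≡ ι₀ a) ⇔ (a ≡ h)
    ιh≡ιa⇔a≡h h = mk⇔ (sym ∘ ι-injective h a) (λ { refl → refl })

  ι₊-off-kernel : (F : Carrier H → ℤ) {g : Carrier G} → ¬ π₀ g ≡ Q.ε → ι₊ F g ≡ 0ℤ
  ι₊-off-kernel F {g} πg≢ε = trans (sum-cong (elems H) vanishes) (sum-zero (elems H))
    where
    vanishes : ∀ h → indicator (_≟_ G (ι₀ h) g) * F h ≡ 0ℤ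
    vanishes h with _≟_ G (ι₀ h) g
    ... | yes refl = ⊥-elim (πg≢ε (π∘ι≡ε h))
    ... | no  _    = refl

  mul-ι₊ˡ : (F : Carrier H → ℤ) (w : ZG G) (x : Carrier G) →
            mulZG G (ι₊ F) w x ≡ sumOver (elems H) (λ h → F h * w (ι₀ h G.\\ x))
  mul-ι₊ˡ F w x = begin
    sumOver xs (λ y → ι₊ F y * w (y G.\\ x))
      ≡⟨ sum-cong xs (λ y → sym (sum-*ʳ hs (w (y G.\\ x)) _)) ⟩
    sumOver xs (λ y → sumOver hs (λ h → indicator (_≟_ G (ι₀ h) y) * F h * w (y G.\\ x)))
      ≡⟨ sum-cong xs (λ y → sum-cong hs (λ h → *-assoc (indicator (_≟_ G (ι₀ h) y)) (F h) _)) ⟩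
    sumOver xs (λ y → sumOver hs (λ h → indicator (_≟_ G (ι₀ h) y) * (F h * w (y G.\\ x))))
      ≡⟨ sum-swap xs hs _ ⟩
    sumOver hs (λ h → sumOver xs (λ y → indicator (_≟_ G (ι₀ h) y) * (F h * w (y G.\\ x))))
      ≡⟨ sum-cong hs (λ h → sum-δ (_≟_ G) xs (λ y → F h * w (y G.\\ x)) (unique G) (complete G (ι₀ h))) ⟩
    sumOver hs (λ h → F h * w (ι₀ h G.\\ x))
      ∎
    where
    open ≡-Reasoning
    xs = elems G
    hs = elems H

  mul-ι₊ʳ : (w : ZG G) (F : Carrier H → ℤ) (x : Carrier G) →
            mulZG G w (ι₊ F) x ≡ sumOver (elems H) (λ h → F h * w (x G.// ι₀ h))
  mul-ι₊ʳ w F x = begin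
    sumOver xs (λ y → w y * ι₊ F (y G.\\ x))
      ≡⟨ sum-cong xs (λ y → sym (sum-*ˡ hs (w y) _)) ⟩
    sumOver xs (λ y → sumOver hs (λ h → w y * (δ (ι₀ h) (y G.\\ x) * F h)))
      ≡⟨ sum-cong xs (λ y → sum-cong hs (λ h → rearrange (w y) (δ (ι₀ h) (y G.\\ x)) (F h))) ⟩
    sumOver xs (λ y → sumOver hs (λ h → δ (ι₀ h) (y G.\\ x) * (F h * w y)))
      ≡⟨ sum-swap xs hs _ ⟩
    sumOver hs (λ h → sumOver xs (λ y → δ (ι₀ h) (y G.\\ x) * (F h * w y)))
      ≡⟨ sum-cong hs (λ h → sum-cong xs (λ y → cong (_* (F h * w y)) (solve-for y (ι₀ h)))) ⟩
    sumOver hs (λ h → sumOver xs (λ y → δ (x G.// ι₀ h) y * (F h * w y)))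
      ≡⟨ sum-cong hs (λ h → sum-δ (_≟_ G) xs (λ y → F h * w y) (unique G) (complete G _)) ⟩
    sumOver hs (λ h → F h * w (x G.// ι₀ h))
      ∎
    where
    open ≡-Reasoning
    xs = elems G
    hs = elems H
    δ : Carrier G → Carrier G → ℤ
    δ a b = indicator (_≟_ G a b)
    rearrange : ∀ a b c → a * (b * c) ≡ b * (c * a)
    rearrange = solve-∀
    solve-for : ∀ y k → δ k (y G.\\ x) ≡ δ (x G.// k) y
    solve-for y k = indicator-⇔
      (mk⇔ (λ { refl → sym (G.x≈z//y y _ x (G.\\-leftDividesˡ y x)) })
           (λ { refl → G.y≈x\\z _ k x (G.//-rightDividesˡ k x) }))
      (_≟_ G k (y G.\\ x)) (_≟_ G (x G.// k) y)

  kernelSize : ℤ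
  kernelSize = sumOver (elems G) (λ y → indicator (_≟_ Q (π₀ y) Q.ε))

  sum-∘π : (Φ : Carrier Q → ℤ) → sumOver (elems G) (λ y → Φ (π₀ y)) ≡ kernelSize * sumOver (elems Q) Φ
  sum-∘π Φ = begin
    sumOver xs (λ y → Φ (π₀ y))
      ≡⟨ sum-fibres (_≟_ Q) xs qs π₀ Φ (unique Q) (λ _ → complete Q _) ⟩
    sumOver qs (λ q → sumOver xs (λ y → indicator (_≟_ Q (π₀ y) q)) * Φ q)
      ≡⟨ sum-cong qs (λ q → cong (_* Φ q) (fibre-size q)) ⟩
    sumOver qs (λ q → kernelSize * Φ q)
      ≡⟨ sum-*ˡ qs kernelSize Φ ⟩
    kernelSize * sumOver qs Φ
      ∎
    where
    open ≡-Reasoning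
    xs = elems G
    qs = elems Q
    fibre-size : ∀ q → sumOver xs (λ y → indicator (_≟_ Q (π₀ y) q)) ≡ kernelSize
    fibre-size q with π-surjective q
    ... | s , refl = trans (sym (sum-translate G s _)) (sum-cong xs (λ y → indicator-⇔
      (mk⇔ (λ πsy≡πs → Q.identityʳ-unique _ _ (trans (sym (homo π s y)) πsy≡πs))
           (λ πy≡ε → trans (homo π s y) (trans (cong (π₀ s Q.∙_) πy≡ε) (Q.identityʳ _))))
      (_≟_ Q (π₀ (s G.∙ y)) (π₀ s)) (_≟_ Q (π₀ y) Q.ε)))

  mul-∘π-∘π : (Φ Ψ : Carrier Q → ℤ) (x : Carrier G) →
              mulZG G (Φ ∘ π₀) (Ψ ∘ π₀) x ≡ kernelSize * mulZG Q Φ Ψ (π₀ x)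
  mul-∘π-∘π Φ Ψ x = trans
    (sum-cong (elems G) (λ y → cong (λ q → Φ (π₀ y) * Ψ q) (π-\\ y)))
    (sum-∘π (λ q → Φ q * Ψ (q Q.\\ π₀ x)))
    where
    π-\\ : ∀ y → π₀ (y G.\\ x) ≡ π₀ y Q.\\ π₀ x
    π-\\ y = trans (homo π _ x) (cong (Q._∙ π₀ x) (hom-⁻¹ π y))

  mul-ι₊-∘π : (F : Carrier H → ℤ) (Φ : Carrier Q → ℤ) (x : Carrier G) →
              mulZG G (ι₊ F) (Φ ∘ π₀) x ≡ sumOver (elems H) F * Φ (π₀ x)
  mul-ι₊-∘π F Φ x = trans (mul-ι₊ˡ F (Φ ∘ π₀) x)
    (trans (sum-cong (elems H) (λ h → cong (λ q → F h * Φ q) (π-ι\\ h x))) (sum-*ʳ (elems H) (Φ (π₀ x)) F))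

  mul-∘π-ι₊ : (Φ : Carrier Q → ℤ) (F : Carrier H → ℤ) (x : Carrier G) →
              mulZG G (Φ ∘ π₀) (ι₊ F) x ≡ Φ (π₀ x) * sumOver (elems H) F
  mul-∘π-ι₊ Φ F x = trans (mul-ι₊ʳ (Φ ∘ π₀) F x)
    (trans (sum-cong (elems H) (λ h → cong (λ q → F h * Φ q) (π-//ι h x)))
           (trans (sum-*ʳ (elems H) (Φ (π₀ x)) F) (*-comm _ (Φ (π₀ x)))))

  mul-ι₊-ι₊ : (F F′ : Carrier H → ℤ) (x : Carrier G) → mulZG G (ι₊ F) (ι₊ F′) x ≡ ι₊ (mulZG H F F′) x
  mul-ι₊-ι₊ F F′ x with _≟_ Q (π₀ x) Q.ε
  ... | yes πx≡ε with kernel⊆image πx≡ε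
  ...   | a , refl = begin
    mulZG G (ι₊ F) (ι₊ F′) (ι₀ a)
      ≡⟨ mul-ι₊ˡ F (ι₊ F′) (ι₀ a) ⟩
    sumOver hs (λ h → F h * ι₊ F′ (ι₀ h G.\\ ι₀ a))
      ≡⟨ sum-cong hs (λ h → cong (λ g → F h * ι₊ F′ g) (ι-\\ h)) ⟩
    sumOver hs (λ h → F h * ι₊ F′ (ι₀ (h H.\\ a)))
      ≡⟨ sum-cong hs (λ h → cong (F h *_) (ι₊-at-ι F′ _)) ⟩
    mulZG H F F′ a
      ≡⟨ sym (ι₊-at-ι (mulZG H F F′) a) ⟩
    ι₊ (mulZG H F F′) (ι₀ a)
      ∎
    where
    open ≡-Reasoning
    hs = elems H
    ι-\\ : ∀ h → ι₀ h G.\\ ι₀ a ≡ ι₀ (h H.\\ a)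
    ι-\\ h = sym (trans (homo ι _ a) (cong (G._∙ ι₀ a) (hom-⁻¹ ι h)))
  mul-ι₊-ι₊ F F′ x | no πx≢ε = trans (mul-ι₊ˡ F (ι₊ F′) x)
    (trans (sum-cong (elems H) (λ h → trans (cong (F h *_) (ι₊-off-kernel F′ (πx≢ε ∘ trans (sym (π-ι\\ h x)))))
                                            (*-zeroʳ (F h))))
           (trans (sum-zero (elems H)) (sym (ι₊-off-kernel (mulZG H F F′) πx≢ε))))

  module Wreath (B₁ : List (Subset Q)) (B₂ : List (Subset H)) (sRing₁ : IsSRing Q B₁) (sRing₂ : IsSRing H B₂)
                where
    private
      module B₁ = BasicSets {Q} {B₁} sRing₁
      module B₂ = BasicSets {H} {B₂} sRing₂

    W : List (Subset G)
    W = wreath ι π B₂ B₁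

    nonUnit : Subset Q → Bool
    nonUnit X = not (isUnitSet Q X)

    data WreathBlock : Subset G → Set where
      kernel-block : ∀ {Y} → Y ∈ B₂ → WreathBlock (image ι Y)
      coset-block  : ∀ {Y} → Y ∈ B₁ → Y Q.ε ≡ false → WreathBlock (preimage π Y)

    nonUnit⇔avoids-ε : ∀ {Y} → Y ∈ B₁ → T (nonUnit Y) ⇔ Y Q.ε ≡ false
    nonUnit⇔avoids-ε {Y} Y∈B₁ =
      subst (λ b → T (not b) ⇔ Y Q.ε ≡ false) (sym (B₁.isUnitSet-basic Y∈B₁)) T-not-≡

    ∈-nonUnits⁻ : ∀ {Y} → Y ∈ filterᵇ nonUnit B₁ → Y ∈ B₁ × Y Q.ε ≡ false
    ∈-nonUnits⁻ Y∈F with ∈-filter⁻ (T? ∘ nonUnit) {xs = B₁} Y∈F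
    ... | Y∈B₁ , nonUnitY = Y∈B₁ , Equivalence.to (nonUnit⇔avoids-ε Y∈B₁) nonUnitY

    wreath-block : ∀ {X} → X ∈ W → WreathBlock X
    wreath-block X∈W with ∈-++⁻ (map (image ι) B₂) X∈W
    ... | inj₁ X∈images with ∈-map⁻ (image ι) X∈images
    ...   | Y , Y∈B₂ , refl = kernel-block Y∈B₂
    wreath-block X∈W | inj₂ X∈preimages with ∈-map⁻ (preimage π) X∈preimages
    ...   | Y , Y∈F , refl = uncurry coset-block (∈-nonUnits⁻ Y∈F)

    image∈W : ∀ {Y} → Y ∈ B₂ → image ι Y ∈ W
    image∈W Y∈B₂ = ∈-++⁺ˡ (∈-map⁺ (image ι) Y∈B₂)

    preimage∈W : ∀ {Y} → Y ∈ B₁ → Y Q.ε ≡ false → preimage π Y ∈ W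
    preimage∈W Y∈B₁ Yε = ∈-++⁺ʳ (map (image ι) B₂)
      (∈-map⁺ (preimage π) (∈-filter⁺ (T? ∘ nonUnit) Y∈B₁ (Equivalence.from (nonUnit⇔avoids-ε Y∈B₁) Yε)))

    wreath-isPartition : IsPartition W
    wreath-isPartition = record
      { nonempty = All.tabulate (nonempty ∘ wreath-block)
      ; covers   = covers
      ; disjoint = AllPairsₚ.++⁺
          (AllPairsₚ.map⁺ (AllPairs.map (image-disjoint ι ι-injective) B₂.disjoint))
          (AllPairsₚ.map⁺ (AllPairsₚ.filter⁺ (T? ∘ nonUnit) (AllPairs.map (λ X∩Y → X∩Y ∘ π₀) B₁.disjoint)))
          (Allₚ.map⁺ (All.tabulate λ _ → Allₚ.map⁺ (All.tabulate λ {Y} Y∈F →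
            kernel-avoids {Y = Y} (proj₂ (∈-nonUnits⁻ Y∈F)))))
      }
      where
      nonempty : ∀ {X} → WreathBlock X → ∃[ g ] X g ≡ true
      nonempty (kernel-block Y∈B₂) with All.lookup B₂.nonempty Y∈B₂
      ... | h , Yh = ι₀ h , image⁺ ι Yh
      nonempty (coset-block Y∈B₁ _) with All.lookup B₁.nonempty Y∈B₁
      ... | q , Yq with π-surjective q
      ...   | g , refl = g , Yq
      covers : ∀ g → Any (λ X → X g ≡ true) W
      covers g with _≟_ Q (π₀ g) Q.ε
      ... | yes πg≡ε with kernel⊆image πg≡ε
      ...   | h , refl with find (B₂.covers h)
      ...     | Y , Y∈B₂ , Yh = lose (image∈W Y∈B₂) (image⁺ ι Yh)
      covers g | no πg≢ε with find (B₁.covers (π₀ g))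
      ... | Y , Y∈B₁ , Yπg = lose (preimage∈W Y∈B₁ (B₁.avoids-ε Y∈B₁ Yπg πg≢ε)) Yπg
      kernel-avoids : ∀ {X Y} → Y Q.ε ≡ false → Disjoint (image ι X) (preimage π Y)
      kernel-avoids {Y = Y} Yε g ιX-g with image⁻ ι ιX-g
      ... | h , _ , refl = trans (cong Y (π∘ι≡ε h)) Yε

    wreath-unitBlock : Any (IsUnitBlock G) W
    wreath-unitBlock with find B₂.unitBlock
    ... | U , U∈B₂ , U-unit = lose (image∈W U∈B₂) (image-unitBlock ι U-unit)

    wreath-inverses : All (λ X → Any (InverseOf G X) W) W
    wreath-inverses = All.tabulate (inverse ∘ wreath-block)
      where
      inverse : ∀ {X} → WreathBlock X → Any (InverseOf G X) W
      inverse (kernel-block Y∈B₂) with find (All.lookup B₂.inverses Y∈B₂)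
      ... | Y′ , Y′∈B₂ , Y′≡Y⁻¹ = lose (image∈W Y′∈B₂) (image-inverse ι Y′≡Y⁻¹)
      inverse (coset-block {Y} Y∈B₁ Yε) with find (All.lookup B₁.inverses Y∈B₁)
      ... | Y′ , Y′∈B₁ , Y′≡Y⁻¹ =
        lose (preimage∈W Y′∈B₁ (trans (Y′≡Y⁻¹ Q.ε) (trans (cong Y Q.ε⁻¹≈ε) Yε)))
             (λ g → trans (Y′≡Y⁻¹ (π₀ g)) (cong Y (sym (hom-⁻¹ π g))))

    kernel-sameBlock : ∀ {a a′} → SameBlock B₂ a a′ → SameBlock W (ι₀ a) (ι₀ a′)
    kernel-sameBlock same with find same
    ... | Y , Y∈B₂ , Ya , Ya′ = lose (image∈W Y∈B₂) (image⁺ ι Ya , image⁺ ι Ya′)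

    coset-sameBlock : ∀ {x x′} → ¬ π₀ x ≡ Q.ε → SameBlock B₁ (π₀ x) (π₀ x′) → SameBlock W x x′
    coset-sameBlock πx≢ε same with find same
    ... | Y , Y∈B₁ , Yπx , Yπx′ = lose (preimage∈W Y∈B₁ (B₁.avoids-ε Y∈B₁ Yπx πx≢ε)) (Yπx , Yπx′)

    record Decomposition (u : ZG G) : Set where
      field
        kernelPart            : Carrier H → ℤ
        quotientPart          : Carrier Q → ℤ
        kernelPart-constant   : Constant B₂ kernelPart
        quotientPart-constant : Constant B₁ quotientPart
        decomposes            : ∀ x → u x ≡ ι₊ kernelPart x + quotientPart (π₀ x)

      on-kernel : ∀ a → u (ι₀ a) ≡ kernelPart a + quotientPart Q.ε
      on-kernel a = trans (decomposes (ι₀ a)) (cong₂ _+_ (ι₊-at-ι kernelPart a) (cong quotientPart (π∘ι≡ε a)))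

      off-kernel : ∀ {x} → ¬ π₀ x ≡ Q.ε → u x ≡ quotientPart (π₀ x)
      off-kernel {x} πx≢ε = trans (decomposes x)
        (trans (cong (_+ quotientPart (π₀ x)) (ι₊-off-kernel kernelPart πx≢ε)) (+-identityˡ _))

    decomposition⇒constant : ∀ {u} → Decomposition u → Constant W u
    decomposition⇒constant {u} d {g} {g′} same with find same
    ... | X , X∈W , Xg , Xg′ = on-block (wreath-block X∈W) Xg Xg′
      where
      open Decomposition d
      on-block : ∀ {X} → WreathBlock X → X g ≡ true → X g′ ≡ true → u g ≡ u g′
      on-block (kernel-block Y∈B₂) ιY-g ιY-g′ with image⁻ ι ιY-g | image⁻ ι ιY-g′
      ... | a , Ya , refl | a′ , Ya′ , refl = trans (on-kernel a)
        (trans (cong (_+ quotientPart Q.ε) (kernelPart-constant (lose Y∈B₂ (Ya , Ya′)))) (sym (on-kernel a′)))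
      on-block (coset-block {Y} Y∈B₁ Yε) Yπg Yπg′ = trans (off-kernel (outside Yπg))
        (trans (quotientPart-constant (lose Y∈B₁ (Yπg , Yπg′))) (sym (off-kernel (outside Yπg′))))
        where
        outside : ∀ {x} → Y (π₀ x) ≡ true → ¬ π₀ x ≡ Q.ε
        outside Yπx πx≡ε = true≢false (trans (sym Yπx) (trans (cong Y πx≡ε) Yε))

    constant⇒decomposition : ∀ {u} → Constant W u → Decomposition u
    constant⇒decomposition {u} u-constant = record
      { kernelPart            = λ h → u (ι₀ h) - u (section Q.ε)
      ; quotientPart          = u ∘ section
      ; kernelPart-constant   = cong (_- u (section Q.ε)) ∘ u-constant ∘ kernel-sameBlock
      ; quotientPart-constant = section-constant
      ; decomposes            = λ x → decomposes x (_≟_ Q (π₀ x) Q.ε)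
      }
      where
      -- On the kernel u also picks up the quotient part u (section ε), hence the subtraction above.
      section : Carrier Q → Carrier G
      section q = proj₁ (π-surjective q)

      π∘section : ∀ q → π₀ (section q) ≡ q
      π∘section q = proj₂ (π-surjective q)

      section-constant : Constant B₁ (u ∘ section)
      section-constant {q} {q′} same with _≟_ Q q Q.ε
      ... | yes refl = cong (u ∘ section) (sym (B₁.sameBlock-ε same refl))
      ... | no  q≢ε  = u-constant (coset-sameBlock (q≢ε ∘ trans (sym (π∘section q)))
                                    (subst₂ (SameBlock B₁) (sym (π∘section q)) (sym (π∘section q′)) same))

      decomposes : ∀ x → Dec (π₀ x ≡ Q.ε) →
                   u x ≡ ι₊ (λ h → u (ι₀ h) - u (section Q.ε)) x + u (section (π₀ x))
      decomposes x (yes πx≡ε) with kernel⊆image πx≡ε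
      ... | a , refl = trans (cancel (u (ι₀ a)) (u (section Q.ε)))
        (sym (cong₂ _+_ (ι₊-at-ι _ a) (cong (u ∘ section) (π∘ι≡ε a))))
        where
        cancel : ∀ a b → a ≡ a - b + b
        cancel = solve-∀
      decomposes x (no πx≢ε) = trans (u-constant (coset-sameBlock πx≢ε same))
        (sym (trans (cong (_+ u (section (π₀ x))) (ι₊-off-kernel _ πx≢ε)) (+-identityˡ _)))
        where
        same : SameBlock B₁ (π₀ x) (π₀ (section (π₀ x)))
        same with find (B₁.covers (π₀ x))
        ... | Y , Y∈B₁ , Yπx = lose Y∈B₁ (Yπx , trans (cong Y (π∘section (π₀ x))) Yπx)

    decomposition-mul : ∀ {u v} → Decomposition u → Decomposition v → Decomposition (mulZG G u v)
    decomposition-mul {u} {v} du dv = record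
      { kernelPart            = mulZG H F F′
      ; quotientPart          = Ψ
      ; kernelPart-constant   = B₂.constant-mul F-constant F′-constant
      ; quotientPart-constant =
          constant-+ (constant-+ (constant-*ˡ (Σ F) Φ′-constant) (constant-*ˡ (Σ F′) Φ-constant))
                     (constant-*ˡ kernelSize (B₁.constant-mul Φ-constant Φ′-constant))
      ; decomposes            = decomposes
      }
      where
      open Decomposition du renaming (kernelPart to F; quotientPart to Φ; kernelPart-constant to F-constant;
                                      quotientPart-constant to Φ-constant; decomposes to u≗)
      open Decomposition dv renaming (kernelPart to F′; quotientPart to Φ′; kernelPart-constant to F′-constant;
                                      quotientPart-constant to Φ′-constant; decomposes to v≗)

      Σ : (Carrier H → ℤ) → ℤ
      Σ = sumOver (elems H)

      Ψ : Carrier Q → ℤ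
      Ψ q = Σ F * Φ′ q + Σ F′ * Φ q + kernelSize * mulZG Q Φ Φ′ q

      decomposes : ∀ x → mulZG G u v x ≡ ι₊ (mulZG H F F′) x + Ψ (π₀ x)
      decomposes x = begin
        mulZG G u v x
          ≡⟨ mulZG-cong G u≗ v≗ x ⟩
        mulZG G (λ g → ι₊ F g + Φ (π₀ g)) (λ g → ι₊ F′ g + Φ′ (π₀ g)) x
          ≡⟨ mulZG-expand G (ι₊ F) (Φ ∘ π₀) (ι₊ F′) (Φ′ ∘ π₀) x ⟩
        mulZG G (ι₊ F) (ι₊ F′) x + mulZG G (ι₊ F) (Φ′ ∘ π₀) x
          + mulZG G (Φ ∘ π₀) (ι₊ F′) x + mulZG G (Φ ∘ π₀) (Φ′ ∘ π₀) x
          ≡⟨ cong₂ _+_ (cong₂ _+_ (cong₂ _+_ (mul-ι₊-ι₊ F F′ x) (mul-ι₊-∘π F Φ′ x)) (mul-∘π-ι₊ Φ F′ x))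
                       (mul-∘π-∘π Φ Φ′ x) ⟩
        ι₊ (mulZG H F F′) x + Σ F * Φ′ (π₀ x) + Φ (π₀ x) * Σ F′ + kernelSize * mulZG Q Φ Φ′ (π₀ x)
          ≡⟨ regroup (ι₊ (mulZG H F F′) x) (Σ F * Φ′ (π₀ x)) (Φ (π₀ x)) (Σ F′)
                     (kernelSize * mulZG Q Φ Φ′ (π₀ x)) ⟩
        ι₊ (mulZG H F F′) x + Ψ (π₀ x)
          ∎
        where
        open ≡-Reasoning
        regroup : ∀ a b c d e → a + b + c * d + e ≡ a + (b + d * c + e)
        regroup = solve-∀

    wreath-isSRing : IsSRing G W
    wreath-isSRing = isSRing wreath-isPartition wreath-unitBlock wreath-inverses
      (λ u-constant v-constant → decomposition⇒constant
        (decomposition-mul (constant⇒decomposition u-constant) (constant⇒decomposition v-constant)))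

    connection-covered : {T : Subset Q} {S : Subset H} → T Q.ε ≡ false →
                         CoveredByBlocks Q B₁ T → CoveredByBlocks H B₂ S →
                         CoveredByBlocks G W (union G (preimage π T) (image ι S))
    connection-covered {T} {S} Tε T-covered S-covered g conn-g with T (π₀ g) in Tπg
    ... | true with find (T-covered (π₀ g) Tπg)
    ...   | Y , Y∈B₁ , Yπg , Y⊆T = lose (preimage∈W Y∈B₁ (B₁.avoids-ε Y∈B₁ Yπg πg≢ε))
                                         (Yπg , λ g′ Yπg′ → cong (_∨ image ι S g′) (Y⊆T (π₀ g′) Yπg′))
      where
      πg≢ε : ¬ π₀ g ≡ Q.ε
      πg≢ε πg≡ε = true≢false (trans (sym Tπg) (trans (cong T πg≡ε) Tε))
    connection-covered {T} {S} Tε T-covered S-covered g conn-g | false with image⁻ ι conn-g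
    ...   | h , Sh , refl with find (S-covered h Sh)
    ...     | Y , Y∈B₂ , Yh , Y⊆S = lose (image∈W Y∈B₂) (image⁺ ι Yh , ιY⊆conn)
      where
      ιY⊆conn : ∀ g′ → image ι Y g′ ≡ true → T (π₀ g′) ∨ image ι S g′ ≡ true
      ιY⊆conn g′ ιY-g′ with image⁻ ι ιY-g′
      ... | h′ , Yh′ , refl = trans (cong (T (π₀ (ι₀ h′)) ∨_) (image⁺ ι (Y⊆S h′ Yh′))) (∨-zeroʳ _)

lemma2p8 : (G H Q : FinGroup) (ι : Hom H G) (π : Hom G Q)
    → IsInjective ι → IsSurjective π
    → (∀ g → (map₀ π g ≡ ε Q → ∃[ h ] map₀ ι h ≡ g) × (∀ h → map₀ π (map₀ ι h) ≡ ε Q))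
    → (T : Subset Q) (S : Subset H) → IsCayleySet Q T → IsCayleySet H S
    → (A : List (Subset G)) → IsWL G (union G (preimage π T) (image ι S)) A
    → ∀ (B₁ : List (Subset Q)) (B₂ : List (Subset H)) → IsWL Q T B₁ → IsWL H S B₂
    → SubringLe G A (wreath ι π B₂ B₁)
lemma2p8 G H Q ι π ι-injective π-surjective exact T S (Tε , _) _ A (_ , _ , A-minimal)
         B₁ B₂ (sRing₁ , T-union , _) (sRing₂ , S-union , _) =
  A-minimal W wreath-isSRing (covered⇒isUnionOfBasic G W
    (connection-covered Tε (isUnionOfBasic⇒covered Q B₁ T-union) (isUnionOfBasic⇒covered H B₂ S-union)))
  where
  open Extension G H Q ι π ι-injective π-surjective exact
  open Wreath B₁ B₂ sRing₁ sRing₂
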